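{- For every integer $n\ge 1$, $|\mathcal{S}_n(1\text{ - }32,\,23\text{ - }1)| = |\mathcal{S}_n(3\text{ - }12,\,21\text{ - }3)| = 2^{n-1}$.
   Context: A permutation of $[n]=\{1,\dots,n\}$ is written as a word $\pi=a_1a_2\cdots a_n$. For a permutation $xyz$ of $\{1,2,3\}$: $\pi$ contains the pattern $x\text{ - }yz$ if there are indices $1\le i<j<n$ such that $a_i,a_j,a_{j+1}$ are in the same relative order as $x,y,z$; $\pi$ contains the pattern $xy\text{ - }z$ if there are indices $i$ and $k$ with $i+1<k\le n$ such that $a_i,a_{i+1},a_k$ are in the same relative order as $x,y,z$. $\pi$ avoids a pattern if it does not contain it. $\mathcal{S}_n(p,q)$ is the set of permutations of $[n]$ avoiding both $p$ and $q$. -}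

module Defs where

open import Data.Nat using (ℕ; suc; _<_; _∸_; _^_)
open import Data.Fin using (Fin; toℕ)
open import Data.Vec using (Vec; lookup)
open import Data.Product using (Σ; ∃; ∃-syntax; _×_; proj₁)
open import Function.Bundles using (Inverse; _⇔_)
open import Relation.Binary.PropositionalEquality using (_≡_; setoid)
open import Relation.Nullary using (¬_)
import Relation.Binary.Construct.On as On

-- A word of length n over the alphabet [n] (encoded 0-based as Fin n).
Word : ℕ → Set
Word n = Vec (Fin n) n

-- The word is a permutation of [n]: all letters are distinct
-- (hence, by finiteness, every letter of [n] occurs exactly once).
IsPerm : ∀ {n} → Word n → Set
IsPerm {n} w = ∀ (i j : Fin n) → lookup w i ≡ lookup w j → i ≡ j

SameOrder : (a b c x y z : ℕ) → Set
SameOrder a b c x y z =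
  ((a < b) ⇔ (x < y)) × ((b < a) ⇔ (y < x)) ×
  ((a < c) ⇔ (x < z)) × ((c < a) ⇔ (z < x)) ×
  ((b < c) ⇔ (y < z)) × ((c < b) ⇔ (z < y))

-- Generalized (dashed) patterns of length 3, given by a permutation xyz of {1,2,3}.
data Pattern : Set where
  _-_·_ : (x y z : ℕ) → Pattern   -- the pattern x-yz
  _·_-_ : (x y z : ℕ) → Pattern   -- the pattern xy-z

val : ∀ {n} → Word n → Fin n → ℕ
val w i = toℕ (lookup w i)

-- Pattern containment, exactly as in the paper (positions 0-based).
Contains : ∀ {n} → Word n → Pattern → Set
Contains {n} w (x - y · z) =
  ∃[ i ] ∃[ j ] ∃[ j' ]
    (toℕ i < toℕ j) × (toℕ j' ≡ suc (toℕ j)) ×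
    SameOrder (val w i) (val w j) (val w j') x y z
Contains {n} w (x · y - z) =
  ∃[ i ] ∃[ i' ] ∃[ k ]
    (toℕ i' ≡ suc (toℕ i)) × (toℕ i' < toℕ k) ×
    SameOrder (val w i) (val w i') (val w k) x y z

Avoids : ∀ {n} → Word n → Pattern → Set
Avoids w p = ¬ Contains w p

InS : (n : ℕ) → Pattern → Pattern → Word n → Set
InS n p q w = IsPerm w × Avoids w p × Avoids w q

-- The set S_n(p,q) has exactly k elements: a bijection between Fin k and
-- the subtype, where elements of the subtype are compared by their underlying word.
HasSize : (n : ℕ) → (Word n → Set) → ℕ → Set
HasSize n P k =
  Inverse (setoid (Fin k)) (On.setoid {B = Σ (Word n) P} (setoid (Word n)) proj₁)

-- In a permutation avoiding 1-32 and 23-1 the largest letter is first or last: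
-- if it had neighbours a and c, then a < c would give an occurrence of 1-32 and
-- c < a one of 23-1.  Deleting it leaves a permutation of the same kind, and
-- conversely prepending or appending a new largest letter creates no occurrence,
-- so the count doubles with each letter.  Complementing the letters exchanges
-- 1-32 with 3-12 and 23-1 with 21-3.

module Submission where

open import Defs
open import Data.Nat
  using (ℕ; zero; suc; _≤_; _<_; _∸_; _^_; z<s; s<s; s<s⁻¹; s≤s⁻¹; _≟_; _<?_; _≤?_)
open import Data.Nat.Properties
  using ( n<1+n; m<n⇒m<1+n; m<1+n⇒m<n∨m≡n; n<1⇒n≡0; <-trans; <-asym; <-irrefl; <-cmp
        ; ≤∧≢⇒<; <⇒≢; <⇒≱; <⇒≤; ≤-reflexive; suc-injective; 1+n≢0; ∸-monoʳ-<; ∸-cancelʳ-< )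
open import Data.Fin as Fin
  using (Fin; toℕ; fromℕ<; opposite; combine; quotient; remainder)
open import Data.Fin.Properties
  using ( toℕ<n; toℕ-injective; toℕ-fromℕ<; remQuot-combine; combine-remQuot
        ; opposite-prop; opposite-involutive; pigeonhole; any? )
open import Data.Vec using (Vec; []; _∷_; lookup; tabulate; map)
open import Data.Vec.Properties
  using (lookup-map; lookup∘tabulate; tabulate∘lookup; tabulate-cong; map-∘; map-cong; map-id)
open import Data.Product using (∃-syntax; _×_; _,_)
open import Data.Sum using (inj₁; inj₂; [_,_]′)
open import Data.Empty using (⊥; ⊥-elim)
open import Function using (id; _∘_; _⇔_; mk⇔)
open import Function.Bundles using (module Equivalence)
import Function.Construct.Composition as Composition
open import Relation.Binary.PropositionalEquality
  using (_≡_; _≢_; ≢-sym; refl; sym; trans; cong; cong-app; subst; subst₂; module ≡-Reasoning)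
open import Relation.Binary.Definitions using (tri<; tri≈; tri>)
open import Relation.Nullary using (yes; no)
open import Relation.Nullary.Decidable using (True; toWitness)

open Equivalence using (to; from)

SameComparison : ℕ → ℕ → ℕ → ℕ → Set
SameComparison a b x y = ((a < b) ⇔ (x < y)) × ((b < a) ⇔ (y < x))

<-sameComparison : ∀ {a b x y} → a < b → x < y → SameComparison a b x y
<-sameComparison a<b x<y =
  mk⇔ (λ _ → x<y) (λ _ → a<b) ,
  mk⇔ (λ b<a → ⊥-elim (<-asym a<b b<a)) (λ y<x → ⊥-elim (<-asym x<y y<x))

>-sameComparison : ∀ {a b x y} → b < a → y < x → SameComparison a b x y
>-sameComparison b<a y<x = let (lt , gt) = <-sameComparison b<a y<x in gt , lt

sameOrder : ∀ {a b c x y z} →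
  SameComparison a b x y → SameComparison a c x z → SameComparison b c y z →
  SameOrder a b c x y z
sameOrder (ab , ba) (ac , ca) (bc , cb) = ab , ba , ac , ca , bc , cb

SameOrder-1-3-2 : ∀ {a b c} → SameOrder a b c 1 3 2 ⇔ (a < c × c < b)
SameOrder-1-3-2 = mk⇔
  (λ (_ , _ , ac , _ , _ , cb) → from ac (s<s z<s) , from cb (s<s (s<s z<s)))
  (λ (a<c , c<b) → sameOrder (<-sameComparison (<-trans a<c c<b) (s<s z<s))
                             (<-sameComparison a<c (s<s z<s))
                             (>-sameComparison c<b (s<s (s<s z<s))))

SameOrder-2-3-1 : ∀ {a b c} → SameOrder a b c 2 3 1 ⇔ (c < a × a < b)
SameOrder-2-3-1 = mk⇔
  (λ (ab , _ , _ , ca , _ , _) → from ca (s<s z<s) , from ab (s<s (s<s z<s)))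
  (λ (c<a , a<b) → sameOrder (<-sameComparison a<b (s<s (s<s z<s)))
                             (>-sameComparison c<a (s<s z<s))
                             (>-sameComparison (<-trans c<a a<b) (s<s z<s)))

SameOrder-resp : ∀ {a b c a′ b′ c′ x y z} → a ≡ a′ → b ≡ b′ → c ≡ c′ →
  SameOrder a b c x y z → SameOrder a′ b′ c′ x y z
SameOrder-resp refl refl refl s = s

SameComparison-complement : ∀ {n k a b x y} → a < n → b < n → x ≤ k → y ≤ k →
  SameComparison a b x y → SameComparison (n ∸ suc a) (n ∸ suc b) (k ∸ x) (k ∸ y)
SameComparison-complement a<n b<n x≤k y≤k (ab , ba) = reverse ba a<n x≤k , reverse ab b<n y≤k
  where
  reverse : ∀ {n k a b x y} → (b < a) ⇔ (y < x) → a < n → x ≤ k →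
            (n ∸ suc a < n ∸ suc b) ⇔ (k ∸ x < k ∸ y)
  reverse {n} ba a<n x≤k = mk⇔
    (λ lt → ∸-monoʳ-< (to ba (s<s⁻¹ (∸-cancelʳ-< {o = n} lt))) x≤k)
    (λ lt → ∸-monoʳ-< (s<s (from ba (∸-cancelʳ-< lt))) a<n)

SameOrder-complement : ∀ {n k a b c x y z} → a < n → b < n → c < n → x ≤ k → y ≤ k → z ≤ k →
  SameOrder a b c x y z →
  SameOrder (n ∸ suc a) (n ∸ suc b) (n ∸ suc c) (k ∸ x) (k ∸ y) (k ∸ z)
SameOrder-complement a<n b<n c<n x≤k y≤k z≤k (ab , ba , ac , ca , bc , cb) = sameOrder
  (SameComparison-complement a<n b<n x≤k y≤k (ab , ba))
  (SameComparison-complement a<n c<n x≤k z≤k (ac , ca))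
  (SameComparison-complement b<n c<n y≤k z≤k (bc , cb))

-- Words as functions ℕ → ℕ

infix 4 _≗[_]_
_≗[_]_ : (ℕ → ℕ) → ℕ → (ℕ → ℕ) → Set
f ≗[ n ] g = ∀ {i} → i < n → f i ≡ g i

letter : ∀ {m n} → Vec (Fin n) m → ℕ → ℕ
letter []      _       = 0
letter (a ∷ w) zero    = toℕ a
letter (a ∷ w) (suc i) = letter w i

letter-toℕ : ∀ {m n} (w : Vec (Fin n) m) k → letter w (toℕ k) ≡ toℕ (lookup w k)
letter-toℕ (a ∷ w) Fin.zero    = refl
letter-toℕ (a ∷ w) (Fin.suc k) = letter-toℕ w k

letter-fromℕ< : ∀ {m n i} (w : Vec (Fin n) m) (i<m : i < m) →
  letter w i ≡ toℕ (lookup w (fromℕ< i<m))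
letter-fromℕ< w i<m = trans (cong (letter w) (sym (toℕ-fromℕ< i<m))) (letter-toℕ w _)

fromFun : ∀ {m n} (f : ℕ → ℕ) → (∀ {i} → i < m → f i < n) → Vec (Fin n) m
fromFun f f< = tabulate (λ k → fromℕ< (f< (toℕ<n k)))

letter-fromFun : ∀ {m n f} (f< : ∀ {i} → i < m → f i < n) → letter (fromFun f f<) ≗[ m ] f
letter-fromFun {f = f} f< {i} i<m = begin
  letter (fromFun f f<) i                           ≡⟨ letter-fromℕ< (fromFun f f<) i<m ⟩
  toℕ (lookup (fromFun f f<) (fromℕ< i<m))          ≡⟨ cong toℕ (lookup∘tabulate _ (fromℕ< i<m)) ⟩
  toℕ (fromℕ< (f< (toℕ<n (fromℕ< i<m))))            ≡⟨ toℕ-fromℕ< _ ⟩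
  f (toℕ (fromℕ< i<m))                              ≡⟨ cong f (toℕ-fromℕ< i<m) ⟩
  f i                                               ∎
  where open ≡-Reasoning

fromFun-letter : ∀ {m n f} (f< : ∀ {i} → i < m → f i < n) (w : Vec (Fin n) m) →
  letter w ≗[ m ] f → fromFun f f< ≡ w
fromFun-letter f< w w≗f = trans (tabulate-cong same) (tabulate∘lookup w)
  where
  same : ∀ k → fromℕ< (f< (toℕ<n k)) ≡ lookup w k
  same k = toℕ-injective (trans (toℕ-fromℕ< _) (trans (sym (w≗f (toℕ<n k))) (letter-toℕ w k)))

Containsᶠ : ℕ → (ℕ → ℕ) → Pattern → Set
Containsᶠ n f (x - y · z) =
  ∃[ i ] ∃[ j ] i < j × suc j < n × SameOrder (f i) (f j) (f (suc j)) x y z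
Containsᶠ n f (x · y - z) =
  ∃[ i ] ∃[ k ] suc i < k × k < n × SameOrder (f i) (f (suc i)) (f k) x y z

Contains⇔Containsᶠ : ∀ {n} (w : Word n) p → Contains w p ⇔ Containsᶠ n (letter w) p
Contains⇔Containsᶠ {n} w (x - y · z) = mk⇔
  (λ (i , j , j′ , i<j , j′≡ , s) →
     toℕ i , toℕ j , i<j , subst (_< n) j′≡ (toℕ<n j′) ,
     SameOrder-resp (sym (letter-toℕ w i)) (sym (letter-toℕ w j))
                    (trans (sym (letter-toℕ w j′)) (cong (letter w) j′≡)) s)
  (λ (i , j , i<j , sj<n , s) →
     let j<n = <-trans (n<1+n j) sj<n ; i<n = <-trans i<j j<n in
     fromℕ< i<n , fromℕ< j<n , fromℕ< sj<n ,
     subst₂ _<_ (sym (toℕ-fromℕ< i<n)) (sym (toℕ-fromℕ< j<n)) i<j ,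
     trans (toℕ-fromℕ< sj<n) (cong suc (sym (toℕ-fromℕ< j<n))) ,
     SameOrder-resp (letter-fromℕ< w i<n) (letter-fromℕ< w j<n) (letter-fromℕ< w sj<n) s)
Contains⇔Containsᶠ {n} w (x · y - z) = mk⇔
  (λ (i , i′ , k , i′≡ , i′<k , s) →
     toℕ i , toℕ k , subst (_< toℕ k) i′≡ i′<k , toℕ<n k ,
     SameOrder-resp (sym (letter-toℕ w i))
                    (trans (sym (letter-toℕ w i′)) (cong (letter w) i′≡))
                    (sym (letter-toℕ w k)) s)
  (λ (i , k , si<k , k<n , s) →
     let si<n = <-trans si<k k<n ; i<n = <-trans (n<1+n i) si<n in
     fromℕ< i<n , fromℕ< si<n , fromℕ< k<n ,
     trans (toℕ-fromℕ< si<n) (cong suc (sym (toℕ-fromℕ< i<n))) ,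
     subst₂ _<_ (sym (toℕ-fromℕ< si<n)) (sym (toℕ-fromℕ< k<n)) si<k ,
     SameOrder-resp (letter-fromℕ< w i<n) (letter-fromℕ< w si<n) (letter-fromℕ< w k<n) s)

record Avoider (n : ℕ) (f : ℕ → ℕ) : Set where
  field
    bounded   : ∀ {i} → i < n → f i < n
    injective : ∀ {i j} → i < n → j < n → f i ≡ f j → i ≡ j
    no-1-32   : ∀ {i j} → i < j → suc j < n → f i < f (suc j) → f (suc j) < f j → ⊥
    no-23-1   : ∀ {i k} → suc i < k → k < n → f k < f i → f i < f (suc i) → ⊥

open Avoider

InS⇔Avoider : ∀ {n} (w : Word n) → InS n (1 - 3 · 2) (2 · 3 - 1) w ⇔ Avoider n (letter w)
InS⇔Avoider {n} w = mk⇔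
  (λ (perm , avoids-1-32 , avoids-23-1) → record
     { bounded   = λ i<n → subst (_< n) (sym (letter-fromℕ< w i<n)) (toℕ<n _)
     ; injective = injective-letter perm
     ; no-1-32   = λ i<j sj<n lt₁ lt₂ → avoids-1-32
         (from contains-1-32 (_ , _ , i<j , sj<n , from SameOrder-1-3-2 (lt₁ , lt₂)))
     ; no-23-1   = λ si<k k<n lt₁ lt₂ → avoids-23-1
         (from contains-23-1 (_ , _ , si<k , k<n , from SameOrder-2-3-1 (lt₁ , lt₂)))
     })
  (λ a →
     (λ i j eq → toℕ-injective (injective a (toℕ<n i) (toℕ<n j)
                   (trans (letter-toℕ w i) (trans (cong toℕ eq) (sym (letter-toℕ w j)))))) ,
     (λ c → let (_ , _ , i<j , sj<n , s) = to contains-1-32 c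
                (lt₁ , lt₂)             = to SameOrder-1-3-2 s
            in no-1-32 a i<j sj<n lt₁ lt₂) ,
     (λ c → let (_ , _ , si<k , k<n , s) = to contains-23-1 c
                (lt₁ , lt₂)              = to SameOrder-2-3-1 s
            in no-23-1 a si<k k<n lt₁ lt₂))
  where
  contains-1-32 : Contains w (1 - 3 · 2) ⇔ Containsᶠ n (letter w) (1 - 3 · 2)
  contains-1-32 = Contains⇔Containsᶠ w (1 - 3 · 2)
  contains-23-1 : Contains w (2 · 3 - 1) ⇔ Containsᶠ n (letter w) (2 · 3 - 1)
  contains-23-1 = Contains⇔Containsᶠ w (2 · 3 - 1)
  injective-letter : IsPerm w → ∀ {i j} → i < n → j < n → letter w i ≡ letter w j → i ≡ j
  injective-letter perm {i} {j} i<n j<n eq = begin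
    i                ≡⟨ toℕ-fromℕ< i<n ⟨
    toℕ (fromℕ< i<n) ≡⟨ cong toℕ (perm _ _ (toℕ-injective lookups≡)) ⟩
    toℕ (fromℕ< j<n) ≡⟨ toℕ-fromℕ< j<n ⟩
    j                ∎
    where
    open ≡-Reasoning
    lookups≡ : toℕ (lookup w (fromℕ< i<n)) ≡ toℕ (lookup w (fromℕ< j<n))
    lookups≡ = trans (sym (letter-fromℕ< w i<n)) (trans eq (letter-fromℕ< w j<n))

Avoider-cong : ∀ {n f g} → f ≗[ n ] g → Avoider n f → Avoider n g
Avoider-cong {n} {f} {g} f≗g a = record
  { bounded   = λ i<n → subst (_< n) (f≗g i<n) (bounded a i<n)
  ; injective = λ i<n j<n eq → injective a i<n j<n (trans (f≗g i<n) (trans eq (sym (f≗g j<n))))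
  ; no-1-32   = λ i<j sj<n lt₁ lt₂ →
      let j<n = <-trans (n<1+n _) sj<n ; i<n = <-trans i<j j<n in
      no-1-32 a i<j sj<n (back i<n sj<n lt₁) (back sj<n j<n lt₂)
  ; no-23-1   = λ si<k k<n lt₁ lt₂ →
      let si<n = <-trans si<k k<n ; i<n = <-trans (n<1+n _) si<n in
      no-23-1 a si<k k<n (back k<n i<n lt₁) (back i<n si<n lt₂)
  }
  where
  back : ∀ {i j} → i < n → j < n → g i < g j → f i < f j
  back i<n j<n = subst₂ _<_ (sym (f≗g i<n)) (sym (f≗g j<n))

Avoider-empty : ∀ {f} → Avoider 0 f
Avoider-empty = record
  { bounded   = λ ()
  ; injective = λ ()
  ; no-1-32   = λ _ ()
  ; no-23-1   = λ _ ()
  }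

Avoider-last-max : ∀ {n f} → f n ≡ n → Avoider (suc n) f ⇔ Avoider n f
Avoider-last-max {n} {f} fn≡n = mk⇔ restrict extend
  where
  restrict : Avoider (suc n) f → Avoider n f
  restrict a = record
    { bounded   = below
    ; injective = λ i<n j<n → injective a (m<n⇒m<1+n i<n) (m<n⇒m<1+n j<n)
    ; no-1-32   = λ i<j sj<n → no-1-32 a i<j (m<n⇒m<1+n sj<n)
    ; no-23-1   = λ si<k k<n → no-23-1 a si<k (m<n⇒m<1+n k<n)
    }
    where
    below : ∀ {i} → i < n → f i < n
    below {i} i<n = ≤∧≢⇒< (s≤s⁻¹ (bounded a (m<n⇒m<1+n i<n)))
      (λ fi≡n → <-irrefl (injective a (m<n⇒m<1+n i<n) (n<1+n n) (trans fi≡n (sym fn≡n))) i<n)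

  extend : Avoider n f → Avoider (suc n) f
  extend a = record
    { bounded   = λ i<sn → case i<sn (λ i<n → m<n⇒m<1+n (bounded a i<n))
                                     (λ { refl → subst (_< suc n) (sym fn≡n) (n<1+n n) })
    ; injective = λ i<sn j<sn eq → case i<sn
        (λ i<n → case j<sn (λ j<n → injective a i<n j<n eq)
                           (λ { refl → ⊥-elim (not-max i<n eq) }))
        (λ { refl → case j<sn (λ j<n → ⊥-elim (not-max j<n (sym eq)))
                              (λ { refl → refl }) })
    ; no-1-32   = λ i<j sj<sn lt₁ lt₂ → case sj<sn (λ sj<n → no-1-32 a i<j sj<n lt₁ lt₂)
        (λ { refl → above-max (n<1+n _) lt₂ })
    ; no-23-1   = λ si<k k<sn lt₁ lt₂ → case k<sn (λ k<n → no-23-1 a si<k k<n lt₁ lt₂)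
        (λ { refl → above-max (<-trans (n<1+n _) si<k) lt₁ })
    }
    where
    case : ∀ {i} {A : Set} → i < suc n → (i < n → A) → (i ≡ n → A) → A
    case i<sn below last = [ below , last ]′ (m<1+n⇒m<n∨m≡n i<sn)
    not-max : ∀ {i} → i < n → f i ≢ f n
    not-max i<n eq = <-irrefl (trans eq fn≡n) (bounded a i<n)
    above-max : ∀ {i} → i < n → f n < f i → ⊥
    above-max i<n lt = <-asym (subst (_< f _) fn≡n lt) (bounded a i<n)

Avoider-first-max : ∀ {n f} → f 0 ≡ n → Avoider (suc n) f ⇔ Avoider n (f ∘ suc)
Avoider-first-max {n} {f} f0≡n = mk⇔ restrict extend
  where
  restrict : Avoider (suc n) f → Avoider n (f ∘ suc)
  restrict a = record
    { bounded   = λ i<n → ≤∧≢⇒< (s≤s⁻¹ (bounded a (s<s i<n)))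
        (λ fsi≡n → 1+n≢0 (injective a (s<s i<n) z<s (trans fsi≡n (sym f0≡n))))
    ; injective = λ i<n j<n eq → suc-injective (injective a (s<s i<n) (s<s j<n) eq)
    ; no-1-32   = λ i<j sj<n → no-1-32 a (s<s i<j) (s<s sj<n)
    ; no-23-1   = λ si<k k<n → no-23-1 a (s<s si<k) (s<s k<n)
    }

  extend : Avoider n (f ∘ suc) → Avoider (suc n) f
  extend a = record
    { bounded   = λ { {zero} _ → subst (_< suc n) (sym f0≡n) (n<1+n n)
                    ; {suc i} i<sn → m<n⇒m<1+n (bounded a (s<s⁻¹ i<sn)) }
    ; injective = λ
        { {zero}  {zero}  _    _    _  → refl
        ; {zero}  {suc j} _    j<sn eq → ⊥-elim (above-max (s<s⁻¹ j<sn) (≤-reflexive eq))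
        ; {suc i} {zero}  i<sn _    eq → ⊥-elim (above-max (s<s⁻¹ i<sn) (≤-reflexive (sym eq)))
        ; {suc i} {suc j} i<sn j<sn eq → cong suc (injective a (s<s⁻¹ i<sn) (s<s⁻¹ j<sn) eq)
        }
    ; no-1-32   = λ
        { {zero}  {zero}  ()
        ; {zero}  {suc j} _   sj<sn lt₁ _ → above-max (s<s⁻¹ sj<sn) (<⇒≤ lt₁)
        ; {suc i} {suc j} i<j sj<sn       → no-1-32 a (s<s⁻¹ i<j) (s<s⁻¹ sj<sn)
        }
    ; no-23-1   = λ
        { {zero}  {k}     1<k  k<sn _ lt₂ → above-max (s<s⁻¹ (<-trans 1<k k<sn)) (<⇒≤ lt₂)
        ; {suc i} {zero}  ()
        ; {suc i} {suc k} si<k k<sn       → no-23-1 a (s<s⁻¹ si<k) (s<s⁻¹ k<sn)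
        }
    }
    where
    above-max : ∀ {i} → i < n → f 0 ≤ f (suc i) → ⊥
    above-max i<n le = <⇒≱ (bounded a i<n) (subst (_≤ f (suc _)) f0≡n le)

Avoider-no-peak : ∀ {n f q} → Avoider n f → suc (suc q) < n →
  f q < f (suc q) → f (suc (suc q)) < f (suc q) → ⊥
Avoider-no-peak {f = f} {q} a ssq<n up down with <-cmp (f q) (f (suc (suc q)))
... | tri< lt _ _ = no-1-32 a (n<1+n q) ssq<n lt down
... | tri≈ _ eq _ = <-irrefl (injective a q<n ssq<n eq) q<ssq
  where
  q<ssq : q < suc (suc q)
  q<ssq = <-trans (n<1+n q) (n<1+n (suc q))
  q<n : q < _
  q<n = <-trans q<ssq ssq<n
... | tri> _ _ gt = no-23-1 a (n<1+n (suc q)) ssq<n gt up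

max-position : ∀ {n} {f : ℕ → ℕ} → (∀ {i} → i < suc n → f i < suc n) →
  (∀ {i j} → i < suc n → j < suc n → f i ≡ f j → i ≡ j) → ∃[ p ] p < suc n × f p ≡ n
max-position {n} {f} f< f-inj with any? (λ (k : Fin (suc n)) → f (toℕ k) ≟ n)
... | yes (k , fk≡n) = toℕ k , toℕ<n k , fk≡n
... | no ¬max = ⊥-elim (collision (pigeonhole (n<1+n n) squeeze))
  where
  below : ∀ k → f (toℕ k) < n
  below k = ≤∧≢⇒< (s≤s⁻¹ (f< (toℕ<n k))) (λ fk≡n → ¬max (k , fk≡n))
  squeeze : Fin (suc n) → Fin n
  squeeze k = fromℕ< (below k)
  collision : ∃[ i ] ∃[ j ] i Fin.< j × squeeze i ≡ squeeze j → ⊥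
  collision (i , j , i<j , eq) = <-irrefl (f-inj (toℕ<n i) (toℕ<n j) values≡) i<j
    where
    values≡ : f (toℕ i) ≡ f (toℕ j)
    values≡ = trans (sym (toℕ-fromℕ< (below i))) (trans (cong toℕ eq) (toℕ-fromℕ< (below j)))

max-at-end : ∀ {n f} → Avoider (suc (suc n)) f → f 0 ≢ suc n → f (suc n) ≡ suc n
max-at-end {n} {f} a f0≢max with max-position (bounded a) (injective a)
... | zero  , _   , fp≡max = ⊥-elim (f0≢max fp≡max)
... | suc q , p<n , fp≡max with m<1+n⇒m<n∨m≡n p<n
...   | inj₂ refl  = fp≡max
...   | inj₁ sq<sn = ⊥-elim (Avoider-no-peak a (s<s sq<sn)
          (below-max (<-trans (n<1+n q) p<n) (<⇒≢ (n<1+n q)))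
          (below-max (s<s sq<sn) (≢-sym (<⇒≢ (n<1+n (suc q))))))
  where
  below-max : ∀ {i} → i < suc (suc n) → i ≢ suc q → f i < f (suc q)
  below-max i<n i≢p = subst (f _ <_) (sym fp≡max) (≤∧≢⇒< (s≤s⁻¹ (bounded a i<n))
    (λ fi≡max → i≢p (injective a i<n p<n (trans fi≡max (sym fp≡max)))))

-- Encoding by the ends at which the successive maxima sit

cons : ℕ → (ℕ → ℕ) → ℕ → ℕ
cons x g zero    = x
cons x g (suc i) = g i

snoc : ℕ → (ℕ → ℕ) → ℕ → ℕ → ℕ
snoc n g x i with i <? n
... | yes _ = g i
... | no  _ = x

snoc-< : ∀ n g x {i} → i < n → snoc n g x i ≡ g i
snoc-< n _ _ {i} i<n with i <? n
... | yes _   = refl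
... | no  i≮n = ⊥-elim (i≮n i<n)

snoc-≡ : ∀ n g x → snoc n g x n ≡ x
snoc-≡ n _ _ with n <? n
... | yes n<n = ⊥-elim (<-irrefl refl n<n)
... | no  _   = refl

cons-agree : ∀ {n x g f} → f 0 ≡ x → g ≗[ n ] f ∘ suc → cons x g ≗[ suc n ] f
cons-agree f0≡x _   {zero}  _    = sym f0≡x
cons-agree _    g≗f {suc i} i<sn = g≗f (s<s⁻¹ i<sn)

snoc-agree : ∀ {n x g f} → f n ≡ x → g ≗[ n ] f → snoc n g x ≗[ suc n ] f
snoc-agree {n} {x} {g} fn≡x g≗f i<sn with m<1+n⇒m<n∨m≡n i<sn
... | inj₁ i<n  = trans (snoc-< n g x i<n) (g≗f i<n)
... | inj₂ refl = trans (snoc-≡ n g x) (sym fn≡x)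

pattern back  = Fin.zero
pattern front = Fin.suc Fin.zero

insertMax : ℕ → Fin 2 → (ℕ → ℕ) → ℕ → ℕ
insertMax n back  g = snoc n g n
insertMax n front g = cons n g

Avoider-insertMax : ∀ {n g} s → Avoider n g → Avoider (suc n) (insertMax n s g)
Avoider-insertMax {n} {g} back a =
  from (Avoider-last-max (snoc-≡ n g n)) (Avoider-cong (λ i<n → sym (snoc-< n g n i<n)) a)
Avoider-insertMax front a = from (Avoider-first-max refl) a

-- The leading binary digit of c says whether the largest letter m + 1 goes last
-- (back) or first (front); the remaining digits build the rest recursively.
build : ∀ m → Fin (2 ^ m) → ℕ → ℕ
build zero    _ _ = 0
build (suc m) c   = insertMax (suc m) (quotient (2 ^ m) c) (build m (remainder {2} (2 ^ m) c))

build-Avoider : ∀ m c → Avoider (suc m) (build m c)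
build-Avoider zero    _ = from (Avoider-last-max refl) Avoider-empty
build-Avoider (suc m) c = Avoider-insertMax (quotient (2 ^ m) c) (build-Avoider m _)

build-combine : ∀ m s r → build (suc m) (combine {2} s r) ≡ insertMax (suc m) s (build m r)
build-combine m s r = cong (λ (s , r) → insertMax (suc m) s (build m r)) (remQuot-combine {2} s r)

index : ∀ m → (ℕ → ℕ) → Fin (2 ^ m)
index zero    _ = Fin.zero
index (suc m) f with f 0 ≟ suc m
... | yes _ = combine {2} front (index m (f ∘ suc))
... | no  _ = combine {2} back (index m f)

index-front : ∀ {m f} → f 0 ≡ suc m → index (suc m) f ≡ combine {2} front (index m (f ∘ suc))
index-front {m} {f} f0≡ with f 0 ≟ suc m
... | yes _   = refl
... | no  f0≢ = ⊥-elim (f0≢ f0≡)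

index-back : ∀ {m f} → f 0 ≢ suc m → index (suc m) f ≡ combine {2} back (index m f)
index-back {m} {f} f0≢ with f 0 ≟ suc m
... | yes f0≡ = ⊥-elim (f0≢ f0≡)
... | no  _   = refl

index-cong : ∀ m {f g} → f ≗[ suc m ] g → index m f ≡ index m g
index-cong zero    _ = refl
index-cong (suc m) {f} {g} f≗g with f 0 ≟ suc m | g 0 ≟ suc m
... | yes _   | yes _   = cong (combine {2} front) (index-cong m (λ i<sm → f≗g (s<s i<sm)))
... | no  _   | no  _   = cong (combine {2} back) (index-cong m (λ i<sm → f≗g (m<n⇒m<1+n i<sm)))
... | yes f0≡ | no  g0≢ = ⊥-elim (g0≢ (trans (sym (f≗g z<s)) f0≡))
... | no  f0≢ | yes g0≡ = ⊥-elim (f0≢ (trans (f≗g z<s) g0≡))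

index-insertMax : ∀ {m g} s → (∀ {i} → i < suc m → g i < suc m) →
  index (suc m) (insertMax (suc m) s g) ≡ combine {2} s (index m g)
index-insertMax {m} {g} back g< =
  trans (index-back {m} {snoc (suc m) g (suc m)} first≢max)
        (cong (combine {2} back) (index-cong m (snoc-< (suc m) g (suc m))))
  where
  first≢max : snoc (suc m) g (suc m) 0 ≢ suc m
  first≢max eq = <⇒≢ (g< z<s) (trans (sym (snoc-< (suc m) g (suc m) z<s)) eq)
index-insertMax {m} {g} front _ = index-front {m} {cons (suc m) g} refl

index-build : ∀ m c → index m (build m c) ≡ c
index-build zero    Fin.zero = refl
index-build (suc m) c        = begin
  index (suc m) (insertMax (suc m) s (build m r)) ≡⟨ index-insertMax s (bounded (build-Avoider m r)) ⟩
  combine {2} s (index m (build m r))             ≡⟨ cong (combine {2} s) (index-build m r) ⟩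
  combine {2} s r                                 ≡⟨ combine-remQuot (2 ^ m) c ⟩
  c                                               ∎
  where
  open ≡-Reasoning
  s : Fin 2
  s = quotient (2 ^ m) c
  r : Fin (2 ^ m)
  r = remainder {2} (2 ^ m) c

build-index : ∀ m {f} → Avoider (suc m) f → build m (index m f) ≗[ suc m ] f
build-index zero    a {zero}  _         = sym (n<1⇒n≡0 (bounded a z<s))
build-index zero    _ {suc _} (s<s ())
build-index (suc m) {f} a with f 0 ≟ suc m
... | yes f0≡ = λ i<n → trans (cong-app (build-combine m front (index m (f ∘ suc))) _)
  (cons-agree {f = f} f0≡ (build-index m (to (Avoider-first-max f0≡) a)) i<n)
... | no f0≢ = λ i<n → trans (cong-app (build-combine m back (index m f)) _)
  (snoc-agree last≡ (build-index m (to (Avoider-last-max last≡) a)) i<n)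
  where
  last≡ : f (suc m) ≡ suc m
  last≡ = max-at-end a f0≢

complement : ∀ {n} → Word n → Word n
complement = map opposite

complement-involutive : ∀ {n} (w : Word n) → complement (complement w) ≡ w
complement-involutive w = begin
  map opposite (map opposite w) ≡⟨ map-∘ opposite opposite w ⟨
  map (opposite ∘ opposite) w   ≡⟨ map-cong opposite-involutive w ⟩
  map id w                      ≡⟨ map-id w ⟩
  w                             ∎
  where open ≡-Reasoning

val-complement : ∀ {n} (w : Word n) i → val (complement w) i ≡ n ∸ suc (val w i)
val-complement w i = trans (cong toℕ (lookup-map i opposite w)) (opposite-prop (lookup w i))

IsPerm-complement : ∀ {n} (w : Word n) → IsPerm w → IsPerm (complement w)
IsPerm-complement w perm i j eq = perm i j (begin
  lookup w i                       ≡⟨ opposite-involutive (lookup w i) ⟨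
  opposite (opposite (lookup w i)) ≡⟨ cong opposite (trans (sym (lookup-map i opposite w))
                                                      (trans eq (lookup-map j opposite w))) ⟩
  opposite (opposite (lookup w j)) ≡⟨ opposite-involutive (lookup w j) ⟩
  lookup w j                       ∎)
  where open ≡-Reasoning

complementᵖ : ℕ → Pattern → Pattern
complementᵖ k (x - y · z) = (k ∸ x) - (k ∸ y) · (k ∸ z)
complementᵖ k (x · y - z) = (k ∸ x) · (k ∸ y) - (k ∸ z)

-- Stated with True so that it holds by computation, as _, for literal patterns.
Letters≤ : ℕ → Pattern → Set
Letters≤ k (x - y · z) = True (x ≤? k) × True (y ≤? k) × True (z ≤? k)
Letters≤ k (x · y - z) = True (x ≤? k) × True (y ≤? k) × True (z ≤? k)

complement-SameOrder : ∀ {n k} (w : Word n) {i j l x y z} →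
  True (x ≤? k) × True (y ≤? k) × True (z ≤? k) →
  SameOrder (val w i) (val w j) (val w l) x y z →
  SameOrder (val (complement w) i) (val (complement w) j) (val (complement w) l) (k ∸ x) (k ∸ y) (k ∸ z)
complement-SameOrder w {i} {j} {l} (x≤k , y≤k , z≤k) s =
  SameOrder-resp (sym (val-complement w i)) (sym (val-complement w j)) (sym (val-complement w l))
    (SameOrder-complement (toℕ<n _) (toℕ<n _) (toℕ<n _) (toWitness x≤k) (toWitness y≤k) (toWitness z≤k) s)

Contains-complement : ∀ {n} (w : Word n) k p → Letters≤ k p → Contains w p →
  Contains (complement w) (complementᵖ k p)
Contains-complement w k (x - y · z) letters (i , j , j′ , i<j , j′≡ , s) =
  i , j , j′ , i<j , j′≡ , complement-SameOrder w letters s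
Contains-complement w k (x · y - z) letters (i , i′ , l , i′≡ , i′<l , s) =
  i , i′ , l , i′≡ , i′<l , complement-SameOrder w letters s

Avoids-complement : ∀ {n} (w : Word n) k p → Letters≤ k p →
  Avoids w (complementᵖ k p) → Avoids (complement w) p
Avoids-complement w k p letters avoids c = avoids
  (subst (λ v → Contains v (complementᵖ k p)) (complement-involutive w)
         (Contains-complement (complement w) k p letters c))

InS-complement : ∀ {n} k p q → Letters≤ k p → Letters≤ k q → (w : Word n) →
  InS n (complementᵖ k p) (complementᵖ k q) w → InS n p q (complement w)
InS-complement k p q p-letters q-letters w (perm , avoids-p , avoids-q) =
  IsPerm-complement w perm ,
  Avoids-complement w k p p-letters avoids-p ,
  Avoids-complement w k q q-letters avoids-q

mkHasSize : ∀ {n k} {P : Word n → Set} (f : Fin k → Word n) (g : Word n → Fin k) →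
  (∀ c → P (f c)) → (∀ c → g (f c) ≡ c) → (∀ {w} → P w → f (g w) ≡ w) →
  HasSize n P k
mkHasSize f g f-P g∘f f∘g = record
  { to        = λ c → f c , f-P c
  ; from      = λ (w , _) → g w
  ; to-cong   = cong f
  ; from-cong = cong g
  ; inverse   = (λ { {w , Pw} refl → f∘g Pw }) , (λ {c} eq → trans (cong g eq) (g∘f c))
  }

HasSize-involution : ∀ {n k} {P Q : Word n → Set} (φ : Word n → Word n) → (∀ w → φ (φ w) ≡ w) →
  (∀ w → P w → Q (φ w)) → (∀ w → Q w → P (φ w)) → HasSize n P k → HasSize n Q k
HasSize-involution φ φ-involutive P⇒Qφ Q⇒Pφ size = Composition.inverse size (record
  { to        = λ (w , Pw) → φ w , P⇒Qφ w Pw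
  ; from      = λ (w , Qw) → φ w , Q⇒Pφ w Qw
  ; to-cong   = cong φ
  ; from-cong = cong φ
  ; inverse   = swap , swap
  })
  where
  swap : ∀ {v w} → v ≡ φ w → φ v ≡ w
  swap {w = w} eq = trans (cong φ eq) (φ-involutive w)

avoiders-count : ∀ m → HasSize (suc m) (InS (suc m) (1 - 3 · 2) (2 · 3 - 1)) (2 ^ m)
avoiders-count m = mkHasSize word code word-InS code-word word-code
  where
  build-bounded : ∀ c {i} → i < suc m → build m c i < suc m
  build-bounded c = bounded (build-Avoider m c)
  word : Fin (2 ^ m) → Word (suc m)
  word c = fromFun (build m c) (build-bounded c)
  code : Word (suc m) → Fin (2 ^ m)
  code w = index m (letter w)
  word-InS : ∀ c → InS (suc m) (1 - 3 · 2) (2 · 3 - 1) (word c)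
  word-InS c = from (InS⇔Avoider (word c))
    (Avoider-cong (λ i<n → sym (letter-fromFun (build-bounded c) i<n)) (build-Avoider m c))
  code-word : ∀ c → code (word c) ≡ c
  code-word c = trans (index-cong m (letter-fromFun (build-bounded c))) (index-build m c)
  word-code : ∀ {w} → InS (suc m) (1 - 3 · 2) (2 · 3 - 1) w → word (code w) ≡ w
  word-code {w} w-InS = fromFun-letter (build-bounded (code w)) w
    (λ i<n → sym (build-index m (to (InS⇔Avoider w) w-InS) i<n))

mainTheorem10 : (n : ℕ) → 1 ≤ n →
    HasSize n (InS n (1 - 3 · 2) (2 · 3 - 1)) (2 ^ (n ∸ 1)) ×
    HasSize n (InS n (3 - 1 · 2) (2 · 1 - 3)) (2 ^ (n ∸ 1))
mainTheorem10 (suc m) _ =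
  avoiders-count m ,
  HasSize-involution complement complement-involutive
    (InS-complement 4 (3 - 1 · 2) (2 · 1 - 3) _ _)
    (InS-complement 4 (1 - 3 · 2) (2 · 3 - 1) _ _)
    (avoiders-count m)
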